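{- For each natural number $d \ge 1$, there exists a finite $d$-regular simple graph $G$ such that for every $r \in \{1, 2, \ldots, d\}$ there is an independent exact $r$-cover $S_r \subseteq V(G)$.
   Context: Let $G$ be a $d$-regular simple graph. For $0 \le r \le d$, an independent exact $r$-cover of $G$ is a subset $S \subseteq V(G)$ such that no edge of $G$ has both endpoints in $S$, and every vertex of $V(G)\setminus S$ is adjacent to exactly $r$ vertices of $S$. -}

module Defs where

open import Data.Nat using (ℕ)
open import Data.Bool using (Bool; true; false)
open import Data.Fin using (Fin)
open import Data.Fin.Subset using (Subset; _∈_; _∉_; _∩_; ∣_∣)
open import Data.Vec using (tabulate)
open import Data.Product using (_×_)
open import Relation.Binary.PropositionalEquality using (_≡_)

record SimpleGraph (n : ℕ) : Set where
  field
    adj   : Fin n → Fin n → Bool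
    sym   : ∀ u v → adj u v ≡ adj v u
    loopless : ∀ v → adj v v ≡ false

open SimpleGraph public

nbhd : ∀ {n} → SimpleGraph n → Fin n → Subset n
nbhd G v = tabulate (adj G v)

degree : ∀ {n} → SimpleGraph n → Fin n → ℕ
degree G v = ∣ nbhd G v ∣

IsRegular : ∀ {n} → SimpleGraph n → ℕ → Set
IsRegular G d = ∀ v → degree G v ≡ d

IsIndependent : ∀ {n} → SimpleGraph n → Subset n → Set
IsIndependent G S = ∀ u v → u ∈ S → v ∈ S → adj G u v ≡ false

IsExactCover : ∀ {n} → SimpleGraph n → Subset n → ℕ → Set
IsExactCover G S r = ∀ v → v ∉ S → ∣ nbhd G v ∩ S ∣ ≡ r

IsIndependentExactCover : ∀ {n} → SimpleGraph n → Subset n → ℕ → Set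
IsIndependentExactCover G S r = IsIndependent G S × IsExactCover G S r

{-# OPTIONS --safe #-}

-- A d-regular graph with a proper d-edge-colouring is the same as d fixpoint-free
-- involutions of the vertex set ("partner along colour c") whose values at each vertex
-- are pairwise distinct. For every r ≤ d a small such graph carries an independent
-- exact r-cover; it is built from the totally symmetric quasigroup
-- a ⋆ b = −(1 + a + b) mod d. The colour-wise product of these graphs for
-- r = 0, …, d is again of this kind, and a cover of any factor pulls back to an
-- independent exact cover of the product with the same r, because colour c moves
-- every coordinate along its own colour-c edge.

module Submission where

open import Defs hiding (sym)
open import Data.Bool using (Bool; true; false; _∧_; _∨_; not)
open import Data.Bool.Properties using (∧-distribʳ-∨; ∧-zeroʳ; ∧-identityʳ; not-involutive; not-¬)
open import Data.Fin using (Fin; zero; suc; toℕ; fromℕ<; inject≤)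
open import Data.Fin.Properties using (_≟_; any?; toℕ<n; toℕ-fromℕ<; toℕ-inject≤; toℕ-injective; fromℕ<-injective; 0≢1+n; suc-injective; 2↔Bool; +↔⊎; *↔×)
open import Data.Fin.Subset using (Subset; _∈_; _∉_; _∩_; ∣_∣)
open import Data.Nat using (ℕ; zero; suc; _+_; _*_; _∸_; _≤_; _<_; z≤n; s≤s; s≤s⁻¹; _<?_; _≤?_)
open import Data.Nat.Properties using (+-suc; +-comm; +-assoc; +-cancelˡ-≡; m≤n+m; m+[n∸m]≡n; m+n∸n≡m; ∸-monoʳ-<; +-mono-<; ≤-trans; ≤-reflexive; ≤-refl; ≰⇒>; <⇒≱; <⇒≤; m≤n⇒m<n∨m≡n; m<n⇒0<n)
open import Data.Product using (Σ; Σ-syntax; ∃-syntax; _×_; _,_; proj₁; proj₂)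
open import Data.Product.Function.NonDependent.Propositional using (_×-↔_)
open import Data.Sum using (_⊎_; inj₁; inj₂)
open import Data.Sum.Properties using (inj₁-injective; inj₂-injective)
open import Data.Vec using (_∷_; []; tabulate)
open import Data.Vec.Properties using (tabulate-cong; lookup∘tabulate; []=⇒lookup; lookup⇒[]=)
open import Function using (_∘_; _↔_; Inverse; Injection; mk⇔)
open import Function.Definitions using (Injective)
open import Function.Properties.Inverse using (↔-refl; ↔-sym; ↔-trans; ↔⇒↣)
open import Relation.Binary.PropositionalEquality using (_≡_; _≢_; refl; sym; trans; cong; cong₂; subst; module ≡-Reasoning)
open import Relation.Nullary using (¬_; yes; no; does; contradiction)
open import Relation.Nullary.Decidable using (dec-true; dec-false; does-⇔)

open ≡-Reasoning

∣tabulate-false∣≡0 : ∀ n → ∣ tabulate {n} (λ _ → false) ∣ ≡ 0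
∣tabulate-false∣≡0 zero    = refl
∣tabulate-false∣≡0 (suc n) = ∣tabulate-false∣≡0 n

∣tabulate-true∣≡n : ∀ n → ∣ tabulate {n} (λ _ → true) ∣ ≡ n
∣tabulate-true∣≡n zero    = refl
∣tabulate-true∣≡n (suc n) = cong suc (∣tabulate-true∣≡n n)

∣x∷p∣≡∣x∷[]∣+∣p∣ : ∀ {n} x (p : Subset n) → ∣ x ∷ p ∣ ≡ ∣ x ∷ [] ∣ + ∣ p ∣
∣x∷p∣≡∣x∷[]∣+∣p∣ true  p = refl
∣x∷p∣≡∣x∷[]∣+∣p∣ false p = refl

tabulate-∩ : ∀ {n} (p q : Fin n → Bool) → tabulate p ∩ tabulate q ≡ tabulate (λ i → p i ∧ q i)
tabulate-∩ {zero}  p q = refl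
tabulate-∩ {suc n} p q = cong (p zero ∧ q zero ∷_) (tabulate-∩ (p ∘ suc) (q ∘ suc))

∣tabulate-∨∣ : ∀ {n} {p q : Fin n → Bool} → (∀ i → p i ∧ q i ≡ false) →
               ∣ tabulate (λ i → p i ∨ q i) ∣ ≡ ∣ tabulate p ∣ + ∣ tabulate q ∣
∣tabulate-∨∣ {zero} _ = refl
∣tabulate-∨∣ {suc n} {p} {q} disjoint with p zero | q zero | disjoint zero
... | true  | true  | ()
... | true  | false | _ = cong suc (∣tabulate-∨∣ (disjoint ∘ suc))
... | false | true  | _ = trans (cong suc (∣tabulate-∨∣ (disjoint ∘ suc))) (sym (+-suc _ _))
... | false | false | _ = ∣tabulate-∨∣ (disjoint ∘ suc)

∣tabulate-≟∧∣ : ∀ {n} (a : Fin n) (q : Fin n → Bool) →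
                ∣ tabulate (λ w → does (a ≟ w) ∧ q w) ∣ ≡ ∣ q a ∷ [] ∣
∣tabulate-≟∧∣ {suc n} zero q with q zero
... | true  = cong suc (∣tabulate-false∣≡0 n)
... | false = ∣tabulate-false∣≡0 n
∣tabulate-≟∧∣ (suc a) q = ∣tabulate-≟∧∣ a (q ∘ suc)

∈-tabulate⁻ : ∀ {n} {p : Fin n → Bool} {i} → i ∈ tabulate p → p i ≡ true
∈-tabulate⁻ {p = p} {i} i∈p = trans (sym (lookup∘tabulate p i)) ([]=⇒lookup i∈p)

∉-tabulate⁻ : ∀ {n} {p : Fin n → Bool} {i} → i ∉ tabulate p → p i ≡ false
∉-tabulate⁻ {p = p} {i} i∉p with p i in eq
... | true  = contradiction (lookup⇒[]= i (tabulate p) (trans (lookup∘tabulate p i) eq)) i∉p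
... | false = refl

inImage : ∀ {m n} → (Fin m → Fin n) → Fin n → Bool
inImage f w = does (any? (λ c → f c ≟ w))

∣image∧∣ : ∀ {m n} (f : Fin m → Fin n) → Injective _≡_ _≡_ f → (q : Fin n → Bool) →
           ∣ tabulate (λ w → inImage f w ∧ q w) ∣ ≡ ∣ tabulate (q ∘ f) ∣
∣image∧∣ {zero} {n} f _ q = ∣tabulate-false∣≡0 n
∣image∧∣ {suc m} f f-inj q = begin
  ∣ tabulate (λ w → (does (f zero ≟ w) ∨ inImage (f ∘ suc) w) ∧ q w) ∣
    ≡⟨ cong ∣_∣ (tabulate-cong (λ w → ∧-distribʳ-∨ (q w) (does (f zero ≟ w)) (inImage (f ∘ suc) w))) ⟩
  ∣ tabulate (λ w → (does (f zero ≟ w) ∧ q w) ∨ (inImage (f ∘ suc) w ∧ q w)) ∣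
    ≡⟨ ∣tabulate-∨∣ disjoint ⟩
  ∣ tabulate (λ w → does (f zero ≟ w) ∧ q w) ∣ + ∣ tabulate (λ w → inImage (f ∘ suc) w ∧ q w) ∣
    ≡⟨ cong₂ _+_ (∣tabulate-≟∧∣ (f zero) q) (∣image∧∣ (f ∘ suc) (suc-injective ∘ f-inj) q) ⟩
  ∣ q (f zero) ∷ [] ∣ + ∣ tabulate (q ∘ f ∘ suc) ∣
    ≡⟨ ∣x∷p∣≡∣x∷[]∣+∣p∣ (q (f zero)) (tabulate (q ∘ f ∘ suc)) ⟨
  ∣ tabulate (q ∘ f) ∣ ∎
  where
  f0∉tail : inImage (f ∘ suc) (f zero) ≡ false
  f0∉tail = dec-false (any? (λ c → f (suc c) ≟ f zero)) (λ (c , eq) → 0≢1+n (sym (f-inj eq)))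

  disjoint : ∀ w → (does (f zero ≟ w) ∧ q w) ∧ (inImage (f ∘ suc) w ∧ q w) ≡ false
  disjoint w with f zero ≟ w
  ... | no _     = refl
  ... | yes refl rewrite f0∉tail = ∧-zeroʳ (q (f zero))

∣image∣ : ∀ {m n} (f : Fin m → Fin n) → Injective _≡_ _≡_ f → ∣ tabulate (inImage f) ∣ ≡ m
∣image∣ {m} f f-inj = begin
  ∣ tabulate (inImage f) ∣                 ≡⟨ cong ∣_∣ (tabulate-cong (λ w → sym (∧-identityʳ (inImage f w)))) ⟩
  ∣ tabulate (λ w → inImage f w ∧ true) ∣  ≡⟨ ∣image∧∣ f f-inj (λ _ → true) ⟩
  ∣ tabulate {m} (λ _ → true) ∣            ≡⟨ ∣tabulate-true∣≡n m ⟩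
  m                                        ∎

∣tabulate∘involution∣ : ∀ {n} (π : Fin n → Fin n) → (∀ x → π (π x) ≡ x) → (q : Fin n → Bool) →
                        ∣ tabulate (q ∘ π) ∣ ≡ ∣ tabulate q ∣
∣tabulate∘involution∣ π π-involutive q = begin
  ∣ tabulate (q ∘ π) ∣                    ≡⟨ ∣image∧∣ π π-injective q ⟨
  ∣ tabulate (λ w → inImage π w ∧ q w) ∣  ≡⟨ cong ∣_∣ (tabulate-cong (λ w → cong (_∧ q w) (π-surjective w))) ⟩
  ∣ tabulate q ∣                          ∎
  where
  π-injective : Injective _≡_ _≡_ π
  π-injective {x} {y} eq = trans (sym (π-involutive x)) (trans (cong π eq) (π-involutive y))
  π-surjective : ∀ w → inImage π w ≡ true
  π-surjective w = dec-true (any? (λ c → π c ≟ w)) (π w , π-involutive w)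

∣tabulate-<∣ : ∀ {n r} → r ≤ n → ∣ tabulate {n} (λ t → does (toℕ t <? r)) ∣ ≡ r
∣tabulate-<∣ {n} z≤n    = ∣tabulate-false∣≡0 n
∣tabulate-<∣ (s≤s r≤n) = cong suc (∣tabulate-<∣ r≤n)

-- (a , b , c) is balanced when a + b + c + 1 ≡ 0 (mod n); the sum is below 3n, so it is
-- then n or 2n. Balance is invariant under permuting a, b, c and determines c from a and b,
-- so the operation a ⋆ b completing (a , b) to a balanced triple is a totally symmetric quasigroup.
Wraps : ℕ → ℕ → Set
Wraps n t = t ≡ n ⊎ t ≡ n + n

complement : ∀ {n} s → s < n + n → Σ[ c ∈ Fin n ] Wraps n (suc s + toℕ c)
complement {n} s s<2n with suc s ≤? n
... | yes 1+s≤n = fromℕ< c<n , inj₁ (trans (cong (suc s +_) (toℕ-fromℕ< c<n)) (m+[n∸m]≡n 1+s≤n))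
  where
  c<n : n ∸ suc s < n
  c<n = ∸-monoʳ-< (s≤s z≤n) 1+s≤n
... | no 1+s≰n = fromℕ< c<n , inj₂ (trans (cong (suc s +_) (toℕ-fromℕ< c<n)) (m+[n∸m]≡n s<2n))
  where
  c<n : n + n ∸ suc s < n
  c<n = ≤-trans (∸-monoʳ-< (≰⇒> 1+s≰n) s<2n) (≤-reflexive (m+n∸n≡m n n))

wraps-gap : ∀ {m c c′ n} → m + c ≡ n → m + c′ ≡ n + n → n ≤ c′
wraps-gap {m} {c} {c′} {n} m+c≡n m+c′≡2n = subst (n ≤_) c+n≡c′ (m≤n+m n c)
  where
  c+n≡c′ : c + n ≡ c′
  c+n≡c′ = +-cancelˡ-≡ m _ _ (begin
    m + (c + n) ≡⟨ +-assoc m c n ⟨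
    m + c + n   ≡⟨ cong (_+ n) m+c≡n ⟩
    n + n       ≡⟨ m+c′≡2n ⟨
    m + c′      ∎)

complement-unique : ∀ {n s c c′} → c < n → c′ < n →
                    Wraps n (suc s + c) → Wraps n (suc s + c′) → c ≡ c′
complement-unique {s = s} _ _ (inj₁ p) (inj₁ q) = +-cancelˡ-≡ (suc s) _ _ (trans p (sym q))
complement-unique {s = s} _ _ (inj₂ p) (inj₂ q) = +-cancelˡ-≡ (suc s) _ _ (trans p (sym q))
complement-unique _ c′<n (inj₁ p) (inj₂ q) = contradiction (wraps-gap p q) (<⇒≱ c′<n)
complement-unique c<n _ (inj₂ p) (inj₁ q) = contradiction (wraps-gap q p) (<⇒≱ c<n)

module _ {n : ℕ} where

  record Balanced (a b c : Fin n) : Set where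
    constructor balanced
    field
      wraps : Wraps n (suc (toℕ a + toℕ b + toℕ c))

  balanced-swap : ∀ {a b c} → Balanced a b c → Balanced b a c
  balanced-swap {a} {b} {c} (balanced w) =
    balanced (subst (λ s → Wraps n (suc (s + toℕ c))) (+-comm (toℕ a) (toℕ b)) w)

  balanced-rotate : ∀ {a b c} → Balanced a b c → Balanced b c a
  balanced-rotate {a} {b} {c} (balanced w) =
    balanced (subst (Wraps n ∘ suc) (trans (+-assoc (toℕ a) (toℕ b) (toℕ c)) (+-comm (toℕ a) (toℕ b + toℕ c))) w)

  infixl 7 _⋆_

  _⋆_ : Fin n → Fin n → Fin n
  a ⋆ b = proj₁ (complement (toℕ a + toℕ b) (+-mono-< (toℕ<n a) (toℕ<n b)))

  ⋆-balanced : ∀ a b → Balanced a b (a ⋆ b)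
  ⋆-balanced a b = balanced (proj₂ (complement (toℕ a + toℕ b) (+-mono-< (toℕ<n a) (toℕ<n b))))

  ⋆-unique : ∀ {a b c} → Balanced a b c → a ⋆ b ≡ c
  ⋆-unique {a} {b} {c} (balanced w) =
    toℕ-injective (complement-unique (toℕ<n (a ⋆ b)) (toℕ<n c) (Balanced.wraps (⋆-balanced a b)) w)

  ⋆-involutiveˡ : ∀ a b → a ⋆ (a ⋆ b) ≡ b
  ⋆-involutiveˡ a b = ⋆-unique (balanced-swap (balanced-rotate (balanced-rotate (⋆-balanced a b))))

  ⋆-involutiveʳ : ∀ a b → a ⋆ b ⋆ b ≡ a
  ⋆-involutiveʳ a b = ⋆-unique (balanced-swap (balanced-rotate (⋆-balanced a b)))

  ⋆-cancelʳ : ∀ b → Injective _≡_ _≡_ (_⋆ b)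
  ⋆-cancelʳ b {a} {a′} eq = begin
    a           ≡⟨ ⋆-involutiveʳ a b ⟨
    a ⋆ b ⋆ b   ≡⟨ cong (_⋆ b) eq ⟩
    a′ ⋆ b ⋆ b  ≡⟨ ⋆-involutiveʳ a′ b ⟩
    a′          ∎

record OneFactorisation (d : ℕ) (V : Set) : Set where
  field
    partner          : Fin d → V → V
    involutive       : ∀ c v → partner c (partner c v) ≡ v
    fixpoint-free    : ∀ c v → partner c v ≢ v
    colour-injective : ∀ v → Injective _≡_ _≡_ (λ c → partner c v)

open OneFactorisation

-- Counting colours instead of neighbours is harmless: partners at a vertex are distinct.
record IndependentCover {d V} (F : OneFactorisation d V) (r : ℕ) : Set where
  field
    member      : V → Bool
    independent : ∀ c v → member v ≡ true → member (partner F c v) ≡ false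
    exact       : ∀ v → member v ≡ false → ∣ tabulate (λ c → member (partner F c v)) ∣ ≡ r

open IndependentCover

module _ {d : ℕ} {V W : Set} (V↔W : V ↔ W) where
  open Inverse V↔W

  to-injective : Injective _≡_ _≡_ to
  to-injective = Injection.injective (↔⇒↣ V↔W)

  transport : OneFactorisation d V → OneFactorisation d W
  transport F = record
    { partner          = λ c w → to (partner F c (from w))
    ; involutive       = λ c w → trans (cong (to ∘ partner F c) (strictlyInverseʳ _))
                                       (trans (cong to (involutive F c (from w))) (strictlyInverseˡ w))
    ; fixpoint-free    = λ c w eq → fixpoint-free F c (from w) (to-injective (trans eq (sym (strictlyInverseˡ w))))
    ; colour-injective = λ w → colour-injective F (from w) ∘ to-injective
    }

  transport-cover : ∀ {F r} → IndependentCover F r → IndependentCover (transport F) r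
  transport-cover {F} S = record
    { member      = member S ∘ from
    ; independent = λ c w w∈S → trans (cong (member S) (strictlyInverseʳ _)) (independent S c (from w) w∈S)
    ; exact       = λ w w∉S → trans (cong ∣_∣ (tabulate-cong {n = d}
                                       (λ c → cong (member S) (strictlyInverseʳ (partner F c (from w))))))
                                    (exact S (from w) w∉S)
    }

infixr 2 _⊗_

_⊗_ : ∀ {d V W} → OneFactorisation d V → OneFactorisation d W → OneFactorisation d (V × W)
F ⊗ G = record
  { partner          = λ c (v , w) → partner F c v , partner G c w
  ; involutive       = λ c (v , w) → cong₂ _,_ (involutive F c v) (involutive G c w)
  ; fixpoint-free    = λ c (v , w) → fixpoint-free F c v ∘ cong proj₁
  ; colour-injective = λ (v , w) → colour-injective F v ∘ cong proj₁
  }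

⊗-coverˡ : ∀ {d V W r} {F : OneFactorisation d V} (G : OneFactorisation d W) →
           IndependentCover F r → IndependentCover (F ⊗ G) r
⊗-coverˡ G S = record
  { member      = member S ∘ proj₁
  ; independent = λ c (v , w) → independent S c v
  ; exact       = λ (v , w) → exact S v
  }

⊗-coverʳ : ∀ {d V W r} (F : OneFactorisation d V) {G : OneFactorisation d W} →
           IndependentCover G r → IndependentCover (F ⊗ G) r
⊗-coverʳ F S = record
  { member      = member S ∘ proj₂
  ; independent = λ c (v , w) → independent S c w
  ; exact       = λ (v , w) → exact S w
  }

module _ {d n} (F : OneFactorisation d (Fin n)) where

  Adjacent : Fin n → Fin n → Set
  Adjacent u w = ∃[ c ] partner F c u ≡ w

  adjacent-sym : ∀ {u w} → Adjacent u w → Adjacent w u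
  adjacent-sym {u} (c , refl) = c , involutive F c u

  graph : SimpleGraph n
  graph = record
    { adj      = λ u → inImage (λ c → partner F c u)
    ; sym      = λ u w → does-⇔ (mk⇔ adjacent-sym adjacent-sym) (any? _) (any? _)
    ; loopless = λ v → dec-false (any? _) (λ (c , eq) → fixpoint-free F c v eq)
    }

  graph-regular : IsRegular graph d
  graph-regular v = ∣image∣ (λ c → partner F c v) (colour-injective F v)

  graph-cover : ∀ {r} → IndependentCover F r → Σ (Subset n) (λ S → IsIndependentExactCover graph S r)
  graph-cover {r} S = tabulate (member S) , independent′ , exact′
    where
    independent′ : IsIndependent graph (tabulate (member S))
    independent′ u v u∈S v∈S = dec-false (any? (λ c → partner F c u ≟ v)) λ where
      (c , refl) → contradiction (trans (sym (∈-tabulate⁻ v∈S)) (independent S c u (∈-tabulate⁻ u∈S))) λ ()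

    exact′ : IsExactCover graph (tabulate (member S)) r
    exact′ v v∉S = begin
      ∣ nbhd graph v ∩ tabulate (member S) ∣           ≡⟨ cong ∣_∣ (tabulate-∩ _ (member S)) ⟩
      ∣ tabulate (λ w → adj graph v w ∧ member S w) ∣  ≡⟨ ∣image∧∣ _ (colour-injective F v) (member S) ⟩
      ∣ tabulate (λ c → member S (partner F c v)) ∣    ≡⟨ exact S v (∉-tabulate⁻ v∉S) ⟩
      r                                                ∎

-- A vertex (i , b , j) is outer for i : Fin d and lies in the cover
-- for i : Fin r. Colour c takes an outer vertex to the cover vertex t = c ⋆ i if t < r, and
-- otherwise to its twin with b flipped and j replaced by t ⋆ j (which keeps these twin edges
-- distinct). Since c ↦ c ⋆ i is a bijection, exactly r colours lead into the cover.
GadgetVertex : ℕ → ℕ → Set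
GadgetVertex d r = (Fin d ⊎ Fin r) × Bool × Fin d

module Gadget {d r : ℕ} (r≤d : r ≤ d) where

  embed : Fin r → Fin d
  embed y = inject≤ y r≤d

  toℕ-embed<r : ∀ y → toℕ (embed y) < r
  toℕ-embed<r y = subst (_< r) (sym (toℕ-inject≤ y r≤d)) (toℕ<n y)

  outerPartner : Fin d → Bool → Fin d → Fin d → GadgetVertex d r
  outerPartner i b j t with toℕ t <? r
  ... | yes t<r = inj₂ (fromℕ< t<r) , b , j
  ... | no  _   = inj₁ i , not b , t ⋆ j

  outerPartner-< : ∀ {i b j t} (t<r : toℕ t < r) → outerPartner i b j t ≡ (inj₂ (fromℕ< t<r) , b , j)
  outerPartner-< {t = t} t<r with toℕ t <? r
  ... | yes _   = refl
  ... | no  t≮r = contradiction t<r t≮r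

  outerPartner-≮ : ∀ {i b j t} → ¬ toℕ t < r → outerPartner i b j t ≡ (inj₁ i , not b , t ⋆ j)
  outerPartner-≮ {t = t} t≮r with toℕ t <? r
  ... | yes t<r = contradiction t<r t≮r
  ... | no  _   = refl

  step : Fin d → GadgetVertex d r → GadgetVertex d r
  step c (inj₁ i , b , j) = outerPartner i b j (c ⋆ i)
  step c (inj₂ y , b , j) = inj₁ (c ⋆ embed y) , b , j

  step-involutive : ∀ c v → step c (step c v) ≡ v
  step-involutive c (inj₁ i , b , j) with toℕ (c ⋆ i) <? r
  ... | yes t<r = begin
    inj₁ (c ⋆ embed (fromℕ< t<r)) , b , j  ≡⟨ cong (λ x → inj₁ (c ⋆ x) , b , j) embed-fromℕ< ⟩
    inj₁ (c ⋆ (c ⋆ i)) , b , j             ≡⟨ cong (λ x → inj₁ x , b , j) (⋆-involutiveˡ c i) ⟩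
    inj₁ i , b , j                         ∎
    where
    embed-fromℕ< : embed (fromℕ< t<r) ≡ c ⋆ i
    embed-fromℕ< = toℕ-injective (trans (toℕ-inject≤ _ r≤d) (toℕ-fromℕ< t<r))
  ... | no t≮r = begin
    outerPartner i (not b) (c ⋆ i ⋆ j) (c ⋆ i)  ≡⟨ outerPartner-≮ t≮r ⟩
    inj₁ i , not (not b) , c ⋆ i ⋆ (c ⋆ i ⋆ j)  ≡⟨ cong₂ (λ b j → inj₁ i , b , j) (not-involutive b) (⋆-involutiveˡ (c ⋆ i) j) ⟩
    inj₁ i , b , j                              ∎
  step-involutive c (inj₂ y , b , j) = begin
    outerPartner (c ⋆ embed y) b j (c ⋆ (c ⋆ embed y))  ≡⟨ cong (outerPartner (c ⋆ embed y) b j) (⋆-involutiveˡ c (embed y)) ⟩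
    outerPartner (c ⋆ embed y) b j (embed y)            ≡⟨ outerPartner-< (toℕ-embed<r y) ⟩
    inj₂ (fromℕ< (toℕ-embed<r y)) , b , j               ≡⟨ cong (λ x → inj₂ x , b , j) fromℕ<-embed ⟩
    inj₂ y , b , j                                      ∎
    where
    fromℕ<-embed : fromℕ< (toℕ-embed<r y) ≡ y
    fromℕ<-embed = toℕ-injective (trans (toℕ-fromℕ< _) (toℕ-inject≤ y r≤d))

  step-fixpoint-free : ∀ c v → step c v ≢ v
  step-fixpoint-free c (inj₁ i , b , j) with toℕ (c ⋆ i) <? r
  ... | yes _ = λ ()
  ... | no  _ = λ eq → not-¬ refl (sym (cong (proj₁ ∘ proj₂) eq))
  step-fixpoint-free c (inj₂ y , b , j) = λ ()

  step-colour-injective : ∀ v → Injective _≡_ _≡_ (λ c → step c v)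
  step-colour-injective (inj₁ i , b , j) {c} {c′} eq with toℕ (c ⋆ i) <? r | toℕ (c′ ⋆ i) <? r
  ... | yes t<r | yes t′<r =
    ⋆-cancelʳ i (toℕ-injective (fromℕ<-injective _ _ t<r t′<r (inj₂-injective (cong proj₁ eq))))
  ... | no _ | no _ = ⋆-cancelʳ i (⋆-cancelʳ j (cong (proj₂ ∘ proj₂) eq))
  step-colour-injective (inj₂ y , b , j) eq = ⋆-cancelʳ (embed y) (inj₁-injective (cong proj₁ eq))

  gadget : OneFactorisation d (GadgetVertex d r)
  gadget = record
    { partner          = step
    ; involutive       = step-involutive
    ; fixpoint-free    = step-fixpoint-free
    ; colour-injective = step-colour-injective
    }

  inCover : GadgetVertex d r → Bool
  inCover (inj₁ _ , _) = false
  inCover (inj₂ _ , _) = true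

  inCover-outerPartner : ∀ i b j t → inCover (outerPartner i b j t) ≡ does (toℕ t <? r)
  inCover-outerPartner i b j t with toℕ t <? r
  ... | yes t<r = sym (dec-true (toℕ t <? r) t<r)
  ... | no  t≮r = sym (dec-false (toℕ t <? r) t≮r)

  gadget-cover : IndependentCover gadget r
  gadget-cover = record
    { member      = inCover
    ; independent = λ { c (inj₂ y , b , j) _ → refl }
    ; exact       = λ { (inj₁ i , b , j) _ → begin
        ∣ tabulate (λ c → inCover (outerPartner i b j (c ⋆ i))) ∣
          ≡⟨ cong ∣_∣ (tabulate-cong (λ c → inCover-outerPartner i b j (c ⋆ i))) ⟩
        ∣ tabulate (λ c → does (toℕ (c ⋆ i) <? r)) ∣
          ≡⟨ ∣tabulate∘involution∣ (_⋆ i) (λ c → ⋆-involutiveʳ c i) (λ t → does (toℕ t <? r)) ⟩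
        ∣ tabulate {d} (λ t → does (toℕ t <? r)) ∣
          ≡⟨ ∣tabulate-<∣ r≤d ⟩
        r ∎ }
    }

gadgetSize : ℕ → ℕ → ℕ
gadgetSize d r = (d + r) * (2 * d)

gadgetVertex↔ : ∀ d r → GadgetVertex d r ↔ Fin (gadgetSize d r)
gadgetVertex↔ d r = ↔-sym (↔-trans *↔× (+↔⊎ ×-↔ ↔-trans *↔× (2↔Bool ×-↔ ↔-refl)))

open Gadget using (gadget; gadget-cover)

TowerVertex : ℕ → ℕ → Set
TowerVertex d zero    = GadgetVertex d 0
TowerVertex d (suc k) = TowerVertex d k × GadgetVertex d (suc k)

towerSize : ℕ → ℕ → ℕ
towerSize d zero    = gadgetSize d 0
towerSize d (suc k) = towerSize d k * gadgetSize d (suc k)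

towerVertex↔ : ∀ d k → TowerVertex d k ↔ Fin (towerSize d k)
towerVertex↔ d zero    = gadgetVertex↔ d 0
towerVertex↔ d (suc k) = ↔-trans (towerVertex↔ d k ×-↔ gadgetVertex↔ d (suc k)) (↔-sym *↔×)

tower : ∀ {d} k → k ≤ d → OneFactorisation d (TowerVertex d k)
tower zero    _   = gadget z≤n
tower (suc k) k<d = tower k (<⇒≤ k<d) ⊗ gadget k<d

tower-cover : ∀ {d} k (k≤d : k ≤ d) {r} → r ≤ k → IndependentCover (tower k k≤d) r
tower-cover zero    _   z≤n = gadget-cover z≤n
tower-cover (suc k) k<d r≤1+k with m≤n⇒m<n∨m≡n r≤1+k
... | inj₁ r<1+k = ⊗-coverˡ (gadget k<d) (tower-cover k (<⇒≤ k<d) (s≤s⁻¹ r<1+k))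
... | inj₂ refl  = ⊗-coverʳ (tower k (<⇒≤ k<d)) (gadget-cover k<d)

towerVertex : ∀ {d} → Fin d → ∀ k → TowerVertex d k
towerVertex i zero    = inj₁ i , false , i
towerVertex i (suc k) = towerVertex i k , inj₁ i , false , i

theorem1p4 : (d : ℕ) → 1 ≤ d →
    Σ ℕ (λ n → 1 ≤ n × Σ (SimpleGraph n) (λ G →
      IsRegular G d ×
      ((r : ℕ) → 1 ≤ r → r ≤ d → Σ (Subset n) (λ S → IsIndependentExactCover G S r))))
theorem1p4 (suc e) _ =
  towerSize d d , m<n⇒0<n (toℕ<n (to (towerVertex zero d))) , graph F , graph-regular F ,
  λ r _ r≤d → graph-cover F (transport-cover (towerVertex↔ d d) (tower-cover d ≤-refl r≤d))
  where
  d : ℕ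
  d = suc e
  open Inverse (towerVertex↔ d d) using (to)
  F : OneFactorisation d (Fin (towerSize d d))
  F = transport (towerVertex↔ d d) (tower d ≤-refl)
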